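{- Let $0<k<n$ be integers such that $s^{n,k}=\frac{n(n+1)}{2k}$ is an even integer. Let $\mathcal P=[p_1,\ldots,p_k]$ be an ascending partition of $n$ of size $k$ of the form $\mathcal P=[2^e,p^f,\ldots]$ with $e,f>0$ and $p\ge 3$, i.e. $p_1=\cdots=p_e=2$, $p_{e+1}=\cdots=p_{e+f}=p$, and $p_i>p$ for all $i>e+f$. Let $c=s^{n,k}-n$, $C=\{x\in[n]:x\ge c\}$, $h=|C|-2e=2n-s^{n,k}+1-2e$, $m=s^{n,k}/2$, $\overline h=\lceil h/2\rceil$ and $\underline h=\lfloor h/2\rfloor$. Suppose $$m+\sum_{i=c-p+1}^{c-1} i<s^{n,k},$$ and define $g=h-f$ if $f\le\underline h$, and $g=\overline h-2(f-\underline h)$ if $f>\underline h$. If either (i) $g<0$, or (ii) $g\ge 0$ and, for $q=p_{e+f+g+1}$, $\sum_{i=c-q}^{c-1} i<s^{n,k}$, then $\mathcal P$ is not equitable.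
   Context: $[n]=\{1,\ldots,n\}$. An ascending partition of $n$ of size $k$ is a sequence of positive integers $p_1\le p_2\le\cdots\le p_k$ with $\sum_i p_i=n$. The notation $[q_1^{e_1},q_2^{e_2},\ldots,q_t^{e_t}]$ with $q_1<q_2<\cdots<q_t$ denotes the ascending partition having exactly $e_i$ parts equal to $q_i$. The ascending partition $[p_1,\ldots,p_k]$ is equitable if $[n]$ can be partitioned into sets $A_1,\ldots,A_k$ with $|A_i|=p_i$ for all $i$ and all the element sums $\sum_{a\in A_i}a$ equal (necessarily to $s^{n,k}$). -}

module Defs where

open import Data.Nat as ℕ using (ℕ; zero; suc)
open import Data.Fin using (Fin; toℕ; _≟_)
open import Data.Fin as F using ()
open import Relation.Nullary using (yes; no)
open import Data.Integer.Properties using () renaming (_≤?_ to _≤ℤ?_)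
open import Data.Integer as ℤ using (ℤ; +_; -[1+_])
open import Data.Integer.DivMod using (_/_)
open import Data.List using (List; map; upTo)
open import Data.List as L using ()
open import Data.Product using (Σ; ∃; _×_; Σ-syntax)
open import Relation.Binary.PropositionalEquality using (_≡_)

sumFin : (n : ℕ) → (Fin n → ℕ) → ℕ
sumFin zero    f = 0
sumFin (suc n) f = f F.zero ℕ.+ sumFin n (λ j → f (F.suc j))

-- An ascending partition of n of size k, given as P : Fin k → ℕ
-- (P i is the (i+1)-st part, i.e. p_{i+1}).
record IsAscendingPartition (n k : ℕ) (P : Fin k → ℕ) : Set where
  field
    positive  : ∀ i → 0 ℕ.< P i
    ascending : ∀ i j → toℕ i ℕ.≤ toℕ j → P i ℕ.≤ P j
    sums-to-n : sumFin k P ≡ n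

ifEq : ∀ {k} → Fin k → Fin k → ℕ → ℕ → ℕ
ifEq a b x y with a ≟ b
... | yes _ = x
... | no  _ = y

blockSize : ∀ {n k} → (Fin n → Fin k) → Fin k → ℕ
blockSize {n} σ i = sumFin n (λ j → ifEq (σ j) i 1 0)

blockSum : ∀ {n k} → (Fin n → Fin k) → Fin k → ℕ
blockSum {n} σ i = sumFin n (λ j → ifEq (σ j) i (suc (toℕ j)) 0)

-- P is equitable: [n] can be partitioned into sets A_1,…,A_k (A_i = σ⁻¹(i),
-- with element x = toℕ j + 1) with |A_i| = p_i and all element sums equal.
Equitable : (n k : ℕ) → (Fin k → ℕ) → Set
Equitable n k P =
  Σ[ σ ∈ (Fin n → Fin k) ]
    ((∀ i → blockSize σ i ≡ P i) × (∀ i i' → blockSum σ i ≡ blockSum σ i'))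

rangeLength : ℤ → ℤ → ℕ
rangeLength a b with b ℤ.- a ℤ.+ + 1
... | + l      = l
... | -[1+ _ ] = 0

-- Σ_{i=a}^{b} i over the integers (empty sum 0 if b < a).
rangeSum : ℤ → ℤ → ℤ
rangeSum a b = L.foldr ℤ._+_ (+ 0) (map (λ j → a ℤ.+ + j) (upTo (rangeLength a b)))

-- ⌊ h / 2 ⌋ and ⌈ h / 2 ⌉ for integers (stdlib's _/_ is Euclidean, i.e. floor for divisor 2)
floorHalf : ℤ → ℤ
floorHalf h = h / + 2

ceilHalf : ℤ → ℤ
ceilHalf h = h ℤ.- floorHalf h

gValue : ℤ → ℕ → ℤ
gValue h f with (+ f) ≤ℤ? floorHalf h
... | yes _ = h ℤ.- + f
... | no  _ = ceilHalf h ℤ.- + 2 ℤ.* (+ f ℤ.- floorHalf h)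

{-# OPTIONS --safe #-}
-- Since elements are at most n, a pair {x, y} lies in C, and as x ≠ y one of them exceeds m.
-- A block of size p has an element above m or two elements in C: otherwise its sum is at
-- most m + Σ_{i=c-p+1}^{c-1} i < s. A block of size at most q meets C as soon as
-- Σ_{i=c-q}^{c-1} i < s, since its elements are distinct.
-- Now |C| ≤ 2(n - m) + 1 = h + 2e, h = 2X + 1, and n - m = X + e elements exceed m (all in C).
-- If f ≤ X, then g = h - f ≥ 0 and the first e + f + g + 1 blocks need 2e + f + g + 1 > |C|
-- elements of C. If f > X, then g = 3X + 1 - 2f; count elements of C plus elements above m:
-- the pairs need 3 each, the p-blocks 2 each and the next g + 1 blocks (none if g < 0) 1 each,
-- more than the 3(X + e) + 1 available.
module Submission where

open import Defs
open import Data.Nat using (ℕ; suc; _+_; _*_; _<_; _≤_)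
open import Data.Fin using (Fin; toℕ)
open import Data.Integer as ℤ using (ℤ; +_)
open import Data.Product using (Σ; _×_; Σ-syntax)
open import Data.Sum using (_⊎_)
open import Relation.Nullary using (¬_)
open import Relation.Binary.PropositionalEquality using (_≡_)

open import Data.Nat using (zero; _∸_; z≤n; s≤s; z<s)
open import Data.Nat.Properties
open import Data.Nat.Tactic.RingSolver using (solve-∀; solve)
open import Data.List using ([]; _∷_; foldr; map; upTo; applyUpTo)
open import Data.List.Properties using (map-applyUpTo; map-upTo; map-cong)
open import Data.Nat.DivMod using (_/_; +-distrib-/-∣ʳ; m*n/n≡m)
open import Data.Nat.Divisibility using (divides-refl)
import Data.Integer.Properties as ℤ
import Data.Integer.Tactic.RingSolver as ℤ-Solver
open import Algebra.Properties.CommutativeSemigroup +-commutativeSemigroup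
  using () renaming (interchange to +-interchange)
open import Data.Fin as Fin using ()
open import Data.Fin.Properties using (toℕ<n; toℕ-fromℕ<) renaming (suc-injective to Fin-suc-injective)
open import Data.Product as Product using (_,_; proj₁; proj₂)
open import Data.Sum as Sum using (inj₁; inj₂; [_,_]′)
open import Data.Empty using (⊥)
open import Function using (_∘_)
open import Relation.Nullary using (Dec; yes; no; contradiction)
open import Relation.Binary.PropositionalEquality
  using (refl; sym; trans; cong; cong₂; subst; subst₂; _≢_; module ≡-Reasoning)

sumFin-cong : ∀ n {f g : Fin n → ℕ} → (∀ j → f j ≡ g j) → sumFin n f ≡ sumFin n g
sumFin-cong zero    eq = refl
sumFin-cong (suc n) eq = cong₂ _+_ (eq Fin.zero) (sumFin-cong n (eq ∘ Fin.suc))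

sumFin-+ : ∀ n (f g : Fin n → ℕ) → sumFin n (λ j → f j + g j) ≡ sumFin n f + sumFin n g
sumFin-+ zero    f g = refl
sumFin-+ (suc n) f g =
  trans (cong (_+_ (f Fin.zero + g Fin.zero)) (sumFin-+ n (f ∘ Fin.suc) (g ∘ Fin.suc)))
        (+-interchange (f Fin.zero) (g Fin.zero) _ _)

sumFin-*ʳ : ∀ n (f : Fin n → ℕ) c → sumFin n (λ j → f j * c) ≡ sumFin n f * c
sumFin-*ʳ zero    f c = refl
sumFin-*ʳ (suc n) f c =
  trans (cong (_+_ (f Fin.zero * c)) (sumFin-*ʳ n (f ∘ Fin.suc) c))
        (sym (*-distribʳ-+ c (f Fin.zero) _))

sumFin-const : ∀ n c → sumFin n (λ _ → c) ≡ n * c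
sumFin-const zero    c = refl
sumFin-const (suc n) c = cong (_+_ c) (sumFin-const n c)

sumFin-zero : ∀ n {f : Fin n → ℕ} → (∀ j → f j ≡ 0) → sumFin n f ≡ 0
sumFin-zero n f≡0 = trans (sumFin-cong n f≡0) (trans (sumFin-const n 0) (*-zeroʳ n))

sumFin-mono : ∀ n {f g : Fin n → ℕ} → (∀ j → f j ≤ g j) → sumFin n f ≤ sumFin n g
sumFin-mono zero    f≤g = z≤n
sumFin-mono (suc n) f≤g = +-mono-≤ (f≤g Fin.zero) (sumFin-mono n (f≤g ∘ Fin.suc))

term≤sumFin : ∀ n (f : Fin n → ℕ) j → f j ≤ sumFin n f
term≤sumFin (suc n) f Fin.zero    = m≤m+n _ _
term≤sumFin (suc n) f (Fin.suc j) = ≤-trans (term≤sumFin n (f ∘ Fin.suc) j) (m≤n+m _ _)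

sumFin-comm : ∀ k n (F : Fin k → Fin n → ℕ) →
  sumFin k (λ i → sumFin n (F i)) ≡ sumFin n (λ j → sumFin k (λ i → F i j))
sumFin-comm zero    n F = sym (sumFin-zero n (λ _ → refl))
sumFin-comm (suc k) n F =
  trans (cong (_+_ (sumFin n (F Fin.zero))) (sumFin-comm k n (F ∘ Fin.suc)))
        (sym (sumFin-+ n (F Fin.zero) _))

module _ {k} {a b : Fin k} {x y : ℕ} where

  ifEq-yes : a ≡ b → ifEq a b x y ≡ x
  ifEq-yes a≡b with a Fin.≟ b
  ... | yes _   = refl
  ... | no  a≢b = contradiction a≡b a≢b

  ifEq-no : a ≢ b → ifEq a b x y ≡ y
  ifEq-no a≢b with a Fin.≟ b
  ... | yes a≡b = contradiction a≡b a≢b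
  ... | no  _   = refl

ifEq-suc : ∀ {k} (a b : Fin k) → ifEq (Fin.suc a) (Fin.suc b) 1 0 ≡ ifEq a b 1 0
ifEq-suc a b = by-cases (a Fin.≟ b)
  where
  by-cases : Dec (a ≡ b) → ifEq (Fin.suc a) (Fin.suc b) 1 0 ≡ ifEq a b 1 0
  by-cases (yes a≡b) = trans (ifEq-yes (cong Fin.suc a≡b)) (sym (ifEq-yes a≡b))
  by-cases (no  a≢b) = trans (ifEq-no (a≢b ∘ Fin-suc-injective)) (sym (ifEq-no a≢b))

ifEq-≤1 : ∀ {k} (a b : Fin k) → ifEq a b 1 0 ≤ 1
ifEq-≤1 a b with a Fin.≟ b
... | yes _ = ≤-refl
... | no  _ = z≤n

ifEq-* : ∀ {k} (a b : Fin k) x → ifEq a b x 0 ≡ ifEq a b 1 0 * x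
ifEq-* a b x with a Fin.≟ b
... | yes _ = sym (+-identityʳ x)
... | no  _ = refl

sumFin-ifEq : ∀ k (a : Fin k) → sumFin k (λ i → ifEq a i 1 0) ≡ 1
sumFin-ifEq (suc k) Fin.zero    = cong suc (sumFin-zero k (λ _ → refl))
sumFin-ifEq (suc k) (Fin.suc a) = trans (sumFin-cong k (ifEq-suc a)) (sumFin-ifEq k a)

atLeast : ℕ → ℕ → ℕ
atLeast zero    y       = 1
atLeast (suc M) zero    = 0
atLeast (suc M) (suc y) = atLeast M y

below : ℕ → ℕ → ℕ
below zero    y       = 0
below (suc M) zero    = 1
below (suc M) (suc y) = below M y

atLeast+below≡1 : ∀ M y → atLeast M y + below M y ≡ 1
atLeast+below≡1 zero    y       = refl
atLeast+below≡1 (suc M) zero    = refl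
atLeast+below≡1 (suc M) (suc y) = atLeast+below≡1 M y

atLeast-yes : ∀ {M y} → M ≤ y → atLeast M y ≡ 1
atLeast-yes {zero}  _         = refl
atLeast-yes {suc M} (s≤s M≤y) = atLeast-yes M≤y

below-no : ∀ {M y} → M ≤ y → below M y ≡ 0
below-no {zero}  _         = refl
below-no {suc M} (s≤s M≤y) = below-no M≤y

atLeast≤1 : ∀ M y → atLeast M y ≤ 1
atLeast≤1 M y = subst (atLeast M y ≤_) (atLeast+below≡1 M y) (m≤m+n _ _)

below≤1 : ∀ M y → below M y ≤ 1
below≤1 M y = subst (below M y ≤_) (atLeast+below≡1 M y) (m≤n+m _ _)

atLeast-antitone : ∀ {M M′} y → M ≤ M′ → atLeast M′ y ≤ atLeast M y
atLeast-antitone {M′ = M′} y       z≤n         = atLeast≤1 M′ y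
atLeast-antitone           zero    (s≤s _)     = z≤n
atLeast-antitone           (suc y) (s≤s M≤M′) = atLeast-antitone y M≤M′

below-+-≤ : ∀ M y {u T} → (y < M → suc u ≤ T) → (M ≤ y → u ≤ T) → below M y + u ≤ T
below-+-≤ M y {u} y<M⇒ M≤y⇒ with y <? M
... | yes y<M = ≤-trans (+-monoˡ-≤ u (below≤1 M y)) (y<M⇒ y<M)
... | no  y≮M = subst (λ z → z + u ≤ _) (sym (below-no (≮⇒≥ y≮M))) (M≤y⇒ (≮⇒≥ y≮M))

below-≤ : ∀ M y {T} → (y < M → 1 ≤ T) → below M y ≤ T
below-≤ M y y<M⇒ = subst (_≤ _) (+-identityʳ _) (below-+-≤ M y y<M⇒ (λ _ → z≤n))

sumFin-below : ∀ k a → a ≤ k → sumFin k (λ i → below a (toℕ i)) ≡ a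
sumFin-below k       zero    _         = sumFin-zero k (λ _ → refl)
sumFin-below (suc k) (suc a) (s≤s a≤k) = cong suc (sumFin-below k a a≤k)

prefix≤sumFin : ∀ {k} (u : Fin k → ℕ) {a} → a ≤ k → (∀ i → toℕ i < a → 1 ≤ u i) → a ≤ sumFin k u
prefix≤sumFin {k} u {a} a≤k u≥1 = begin
  a                                  ≡⟨ sumFin-below k a a≤k ⟨
  sumFin k (λ i → below a (toℕ i))   ≤⟨ sumFin-mono k (λ i → below-≤ a (toℕ i) (u≥1 i)) ⟩
  sumFin k u                         ∎
  where open ≤-Reasoning

sumFin-atLeast : ∀ n M → sumFin n (λ j → atLeast M (toℕ j)) ≡ n ∸ M
sumFin-atLeast n       zero    = trans (sumFin-const n 1) (*-identityʳ n)
sumFin-atLeast zero    (suc M) = refl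
sumFin-atLeast (suc n) (suc M) = sumFin-atLeast n M

-- A 0/1 vector a : Fin n → ℕ is a subset of [n]; index j stands for the element toℕ j + 1.
ZeroOne : ∀ {n} → (Fin n → ℕ) → Set
ZeroOne a = ∀ j → a j ≤ 1

size : ∀ {n} → (Fin n → ℕ) → ℕ
size {n} a = sumFin n a

weightedSum : ∀ {n} → (Fin n → ℕ) → (ℕ → ℕ) → ℕ
weightedSum {n} a w = sumFin n (λ j → a j * w (toℕ j))

elemSum : ∀ {n} → (Fin n → ℕ) → ℕ
elemSum a = weightedSum a suc

SupportedBelow : ∀ {n} → ℕ → (Fin n → ℕ) → Set
SupportedBelow M a = ∀ j → M ≤ toℕ j → a j ≡ 0

_↾<_ : ∀ {n} → (Fin n → ℕ) → ℕ → Fin n → ℕ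
(a ↾< M) j = a j * below M (toℕ j)

_↾≥_ : ∀ {n} → (Fin n → ℕ) → ℕ → Fin n → ℕ
(a ↾≥ M) j = a j * atLeast M (toℕ j)

module _ {n} (a : Fin n → ℕ) (M : ℕ) where

  ↾-split : ∀ j → a j ≡ (a ↾< M) j + (a ↾≥ M) j
  ↾-split j = begin
    a j                                         ≡⟨ *-identityʳ (a j) ⟨
    a j * 1                                     ≡⟨ cong (a j *_) (atLeast+below≡1 M (toℕ j)) ⟨
    a j * (atLeast M (toℕ j) + below M (toℕ j)) ≡⟨ *-distribˡ-+ (a j) _ _ ⟩
    (a ↾≥ M) j + (a ↾< M) j                     ≡⟨ +-comm ((a ↾≥ M) j) _ ⟩
    (a ↾< M) j + (a ↾≥ M) j                     ∎
    where open ≡-Reasoning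

  size-split : size a ≡ size (a ↾< M) + size (a ↾≥ M)
  size-split = trans (sumFin-cong n ↾-split) (sumFin-+ n (a ↾< M) (a ↾≥ M))

  weightedSum-split : ∀ w → weightedSum a w ≡ weightedSum (a ↾< M) w + weightedSum (a ↾≥ M) w
  weightedSum-split w =
    trans (sumFin-cong n (λ j → trans (cong (_* w (toℕ j)) (↾-split j))
                                      (*-distribʳ-+ (w (toℕ j)) ((a ↾< M) j) _)))
          (sumFin-+ n (λ j → (a ↾< M) j * w (toℕ j)) (λ j → (a ↾≥ M) j * w (toℕ j)))

  ↾<-zeroOne : ZeroOne a → ZeroOne (a ↾< M)
  ↾<-zeroOne a≤1 j = ≤-trans (*-monoʳ-≤ (a j) (below≤1 M (toℕ j)))
                             (≤-trans (≤-reflexive (*-identityʳ (a j))) (a≤1 j))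

  ↾<-supportedBelow : SupportedBelow M (a ↾< M)
  ↾<-supportedBelow j M≤j = trans (cong (a j *_) (below-no M≤j)) (*-zeroʳ (a j))

  ↾≥-empty : size (a ↾≥ M) ≡ 0 → SupportedBelow M a
  ↾≥-empty size≡0 j M≤j = begin
    a j                    ≡⟨ *-identityʳ (a j) ⟨
    a j * 1                ≡⟨ cong (a j *_) (atLeast-yes M≤j) ⟨
    a j * atLeast M (toℕ j) ≡⟨ n≤0⇒n≡0 (subst ((a ↾≥ M) j ≤_) size≡0 (term≤sumFin n (a ↾≥ M) j)) ⟩
    0                      ∎
    where open ≡-Reasoning

size-↾≥-antitone : ∀ {n} (a : Fin n → ℕ) {M M′} → M ≤ M′ → size (a ↾≥ M′) ≤ size (a ↾≥ M)
size-↾≥-antitone {n} a M≤M′ = sumFin-mono n (λ j → *-monoʳ-≤ (a j) (atLeast-antitone (toℕ j) M≤M′))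

elemSum≤size* : ∀ {n} (a : Fin n → ℕ) {B} → SupportedBelow B a → elemSum a ≤ size a * B
elemSum≤size* {n} a {B} supp =
  ≤-trans (sumFin-mono n bound) (≤-reflexive (sumFin-*ʳ n a B))
  where
  bound : ∀ j → a j * suc (toℕ j) ≤ a j * B
  bound j with toℕ j <? B
  ... | yes j<B = *-monoʳ-≤ (a j) j<B
  ... | no  j≮B = subst (λ x → x * suc (toℕ j) ≤ x * B) (sym (supp j (≮⇒≥ j≮B))) z≤n

elemSum-suc : ∀ {n} (a : Fin (suc n) → ℕ) →
  elemSum a ≡ a Fin.zero + (elemSum (a ∘ Fin.suc) + size (a ∘ Fin.suc))
elemSum-suc {n} a = cong₂ _+_ (*-identityʳ (a Fin.zero)) (begin
  sumFin n (λ j → a (Fin.suc j) * suc (suc (toℕ j)))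
    ≡⟨ sumFin-cong n (λ j → trans (*-suc (a (Fin.suc j)) _) (+-comm (a (Fin.suc j)) _)) ⟩
  sumFin n (λ j → a (Fin.suc j) * suc (toℕ j) + a (Fin.suc j))
    ≡⟨ sumFin-+ n (λ j → a (Fin.suc j) * suc (toℕ j)) (a ∘ Fin.suc) ⟩
  elemSum (a ∘ Fin.suc) + size (a ∘ Fin.suc) ∎)
  where open ≡-Reasoning

-- 2S + r² ≤ r(2M + 1) says S ≤ M + (M - 1) + ... + (M - r + 1).
top-bound : ∀ {n} (a : Fin n → ℕ) M → ZeroOne a → SupportedBelow M a →
  size a ≤ M × 2 * elemSum a + size a * size a ≤ size a * (2 * M + 1)
top-bound {zero}  a M       _   _    = z≤n , z≤n
top-bound {suc n} a zero    _   supp =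
  subst₂ (λ r S → r ≤ 0 × 2 * S + r * r ≤ r * 1) (sym size≡0) (sym elemSum≡0) (z≤n , z≤n)
  where
  size≡0 : size a ≡ 0
  size≡0 = sumFin-zero (suc n) (λ j → supp j z≤n)
  elemSum≡0 : elemSum a ≡ 0
  elemSum≡0 = sumFin-zero (suc n) (λ j → cong (_* suc (toℕ j)) (supp j z≤n))
top-bound {suc n} a (suc M) a≤1 supp =
  subst (λ S → size a ≤ suc M × 2 * S + size a * size a ≤ size a * (2 * suc M + 1))
    (sym (elemSum-suc a))
    (step (a Fin.zero) (a≤1 Fin.zero)
      (top-bound (a ∘ Fin.suc) M (a≤1 ∘ Fin.suc) (λ j M≤j → supp (Fin.suc j) (s≤s M≤j))))
  where
  step : ∀ x {r S} → x ≤ 1 → r ≤ M × 2 * S + r * r ≤ r * (2 * M + 1) →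
    x + r ≤ suc M × 2 * (x + (S + r)) + (x + r) * (x + r) ≤ (x + r) * (2 * suc M + 1)
  step 0 {r} {S} _ (r≤M , ih) = m≤n⇒m≤1+n r≤M , (begin
    2 * (S + r) + r * r      ≡⟨ solve (S ∷ r ∷ []) ⟩
    2 * S + r * r + 2 * r    ≤⟨ +-monoˡ-≤ (2 * r) ih ⟩
    r * (2 * M + 1) + 2 * r  ≡⟨ solve (r ∷ M ∷ []) ⟩
    r * (2 * suc M + 1)      ∎)
    where open ≤-Reasoning
  step 1 {r} {S} _ (r≤M , ih) = s≤s r≤M , (begin
    2 * (1 + (S + r)) + (1 + r) * (1 + r)    ≡⟨ solve (S ∷ r ∷ []) ⟩
    2 * S + r * r + (2 * r + 2 * r + 3)
      ≤⟨ +-mono-≤ ih (+-monoˡ-≤ 3 (+-monoʳ-≤ (2 * r) (*-monoʳ-≤ 2 r≤M))) ⟩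
    r * (2 * M + 1) + (2 * r + 2 * M + 3)    ≡⟨ solve (r ∷ M ∷ []) ⟩
    (1 + r) * (2 * suc M + 1)                ∎)
    where open ≤-Reasoning
  step (suc (suc _)) (s≤s ())

bottom-bound : ∀ {n} (a : Fin n → ℕ) → ZeroOne a → size a * size a + size a ≤ 2 * elemSum a
bottom-bound {zero}  a _   = z≤n
bottom-bound {suc n} a a≤1 =
  subst (λ S → size a * size a + size a ≤ 2 * S) (sym (elemSum-suc a))
    (step (a Fin.zero) (a≤1 Fin.zero) (bottom-bound (a ∘ Fin.suc) (a≤1 ∘ Fin.suc)))
  where
  step : ∀ x {r S} → x ≤ 1 → r * r + r ≤ 2 * S → (x + r) * (x + r) + (x + r) ≤ 2 * (x + (S + r))
  step 0 {r} {S} _ ih = ≤-trans ih (*-monoʳ-≤ 2 (m≤m+n S r))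
  step 1 {r} {S} _ ih = begin
    (1 + r) * (1 + r) + (1 + r)  ≡⟨ solve (r ∷ []) ⟩
    r * r + r + (2 * r + 2)      ≤⟨ +-monoˡ-≤ (2 * r + 2) ih ⟩
    2 * S + (2 * r + 2)          ≡⟨ solve (S ∷ r ∷ []) ⟩
    2 * (1 + (S + r))            ∎
    where open ≤-Reasoning
  step (suc (suc _)) (s≤s ())

elemSum≤size*n : ∀ {n} (a : Fin n → ℕ) → elemSum a ≤ size a * n
elemSum≤size*n a = elemSum≤size* a (λ j n≤j → contradiction n≤j (<⇒≱ (toℕ<n j)))

-- With c = s - n, element toℕ j + 1 lies in C iff s ∸ suc n ≤ toℕ j, so a ↾≥ (s ∸ suc n)
-- is the part of a in C; truncation makes this all of a when s ≤ n.
0<threshold⇒n<s : ∀ {n s} → 0 < s ∸ suc n → n < s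
0<threshold⇒n<s pos = <⇒≤ (m∸n≢0⇒n<m (>⇒≢ pos))

threshold-split : ∀ {n s} → n < s → suc n + (s ∸ suc n) ≡ s
threshold-split = m+[n∸m]≡n

-- Σ_{i=M-r}^{M} i = Σ_{i=M-r+1}^{M} i + (M - r).
top-bound-pred : ∀ {S r M} → 2 * S + suc r * suc r ≤ suc r * (2 * M + 1) →
  2 * S + r * r ≤ r * (2 * M + 1) + 2 * M
top-bound-pred {S} {r} {M} hyp = +-cancelʳ-≤ (2 * r + 1) _ _ (begin
  2 * S + r * r + (2 * r + 1)         ≡⟨ solve (S ∷ r ∷ []) ⟩
  2 * S + suc r * suc r               ≤⟨ hyp ⟩
  suc r * (2 * M + 1)                 ≡⟨ solve (r ∷ M ∷ []) ⟩
  r * (2 * M + 1) + 2 * M + 1         ≤⟨ +-monoˡ-≤ 1 (m≤m+n _ (2 * r)) ⟩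
  r * (2 * M + 1) + 2 * M + 2 * r + 1 ≡⟨ solve (r ∷ M ∷ []) ⟩
  r * (2 * M + 1) + 2 * M + (2 * r + 1) ∎)
  where open ≤-Reasoning

-- r ↦ r(2M + 1) - r² is increasing on [0, M] ...
top-mono : ∀ {r q M} → r ≤ q → q ≤ M → r * (2 * M + 1) + q * q ≤ q * (2 * M + 1) + r * r
top-mono {r} {q} {M} r≤q q≤M with m≤n⇒∃[o]m+o≡n r≤q
... | d , refl = begin
  r * (2 * M + 1) + (r + d) * (r + d)          ≡⟨ solve (r ∷ d ∷ M ∷ []) ⟩
  r * (2 * M + 1) + r * r + d * (2 * r + d)    ≤⟨ +-monoʳ-≤ _ (*-monoʳ-≤ d 2r+d≤2M+1) ⟩
  r * (2 * M + 1) + r * r + d * (2 * M + 1)    ≡⟨ solve (r ∷ d ∷ M ∷ []) ⟩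
  (r + d) * (2 * M + 1) + r * r                ∎
  where
  open ≤-Reasoning
  2r+d≤2M+1 : 2 * r + d ≤ 2 * M + 1
  2r+d≤2M+1 = begin
    2 * r + d       ≡⟨ solve (r ∷ d ∷ []) ⟩
    r + (r + d)     ≤⟨ +-mono-≤ (≤-trans (m≤m+n r d) q≤M) q≤M ⟩
    M + M           ≤⟨ m≤m+n (M + M) 1 ⟩
    M + M + 1       ≡⟨ solve (M ∷ []) ⟩
    2 * M + 1       ∎

-- ... with maximum M(M + 1) there.
top-max : ∀ {r M} → r ≤ M → r * (2 * M + 1) ≤ M * M + M + r * r
top-max {r} {M} r≤M with m≤n⇒∃[o]m+o≡n r≤M
... | d , refl = begin
  r * (2 * (r + d) + 1)                        ≤⟨ m≤m+n _ (d * d + d) ⟩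
  r * (2 * (r + d) + 1) + (d * d + d)          ≡⟨ solve (r ∷ d ∷ []) ⟩
  (r + d) * (r + d) + (r + d) + r * r          ∎
  where open ≤-Reasoning

-- Blocks with sum s

pair-arith : ∀ {rL t M n} → rL + t ≡ 2 → 0 < rL → M ≤ n → rL * M + t * n ≤ M + n
pair-arith {0}                  _    ()
pair-arith {1} {M = M} {n} refl _ _   = ≤-reflexive (cong₂ _+_ (*-identityˡ M) (*-identityˡ n))
pair-arith {2} {M = M} {n} refl _ M≤n = begin
  2 * M + 0 * n ≡⟨ solve (M ∷ n ∷ []) ⟩
  M + M         ≤⟨ +-monoʳ-≤ M M≤n ⟩
  M + n         ∎
  where open ≤-Reasoning
pair-arith {suc (suc (suc _))} ()

p-block-arith : ∀ {t rL p′ SL SH M m} → t + rL ≡ suc p′ → t ≤ 1 →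
  2 * SL + rL * rL ≤ rL * (2 * M + 1) → SH ≤ t * m → M ≤ m →
  2 * (SL + SH) + p′ * p′ ≤ p′ * (2 * M + 1) + 2 * m
p-block-arith {0} {p′ = p′} {SL} {SH} {M} {m} refl _ top SH≤0 M≤m = begin
  2 * (SL + SH) + p′ * p′      ≡⟨ cong (λ x → 2 * (SL + x) + p′ * p′) (n≤0⇒n≡0 SH≤0) ⟩
  2 * (SL + 0) + p′ * p′       ≡⟨ solve (SL ∷ p′ ∷ []) ⟩
  2 * SL + p′ * p′             ≤⟨ top-bound-pred {SL} {p′} {M} top ⟩
  p′ * (2 * M + 1) + 2 * M     ≤⟨ +-monoʳ-≤ (p′ * (2 * M + 1)) (*-monoʳ-≤ 2 M≤m) ⟩
  p′ * (2 * M + 1) + 2 * m     ∎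
  where open ≤-Reasoning
p-block-arith {1} {p′ = p′} {SL} {SH} {M} {m} refl _ top SH≤m _ = begin
  2 * (SL + SH) + p′ * p′      ≡⟨ solve (SL ∷ SH ∷ p′ ∷ []) ⟩
  2 * SL + p′ * p′ + 2 * SH    ≤⟨ +-mono-≤ top (*-monoʳ-≤ 2 (≤-trans SH≤m (≤-reflexive (*-identityˡ m)))) ⟩
  p′ * (2 * M + 1) + 2 * m     ∎
  where open ≤-Reasoning
p-block-arith {suc (suc _)} _ (s≤s ())

small-block-arith : ∀ {r q M s} → r ≤ q → r ≤ M →
  2 * s + r * r ≤ r * (2 * M + 1) → q * q + q ≤ 2 * s → q * (2 * M + 1) < 2 * s + q * q → ⊥
small-block-arith {r} {q} {M} {s} r≤q r≤M top bottom hyp with q ≤? M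
... | yes q≤M = <-irrefl refl (begin-strict
  2 * s + r * r + q * q   ≤⟨ +-monoˡ-≤ (q * q) top ⟩
  r * (2 * M + 1) + q * q ≤⟨ top-mono r≤q q≤M ⟩
  q * (2 * M + 1) + r * r <⟨ +-monoˡ-< (r * r) hyp ⟩
  2 * s + q * q + r * r   ≡⟨ solve (s ∷ q ∷ r ∷ []) ⟩
  2 * s + r * r + q * q   ∎)
  where open ≤-Reasoning
... | no  q≰M = <-irrefl refl (begin-strict
  2 * s + r * r           ≤⟨ top ⟩
  r * (2 * M + 1)         ≤⟨ top-max r≤M ⟩
  M * M + M + r * r       <⟨ +-monoˡ-< (r * r) (+-mono-≤-< (*-mono-≤ (<⇒≤ M<q) (<⇒≤ M<q)) M<q) ⟩
  q * q + q + r * r       ≤⟨ +-monoˡ-≤ (r * r) bottom ⟩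
  2 * s + r * r           ∎)
  where
  open ≤-Reasoning
  M<q : M < q
  M<q = ≰⇒> q≰M

↾<-nonempty⇒0<M : ∀ {n} (a : Fin n → ℕ) M → 0 < size (a ↾< M) → 0 < M
↾<-nonempty⇒0<M {n} a zero    pos = contradiction (sumFin-zero n (λ j → *-zeroʳ (a j))) (>⇒≢ pos)
↾<-nonempty⇒0<M     a (suc M) _   = z<s

module _ {n} (a : Fin n → ℕ) (a≤1 : ZeroOne a) where

  -- The larger element of the pair is at most n, so the smaller one is at least s - n = c.
  pair-⊆-C : ∀ {s} → size a ≡ 2 → elemSum a ≡ s → size (a ↾≥ (s ∸ suc n)) ≡ 2
  pair-⊆-C {s} size≡2 sum≡s = subst (λ x → x + size (a ↾≥ M) ≡ 2) rL≡0 rL+t≡2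
    where
    M = s ∸ suc n
    rL+t≡2 : size (a ↾< M) + size (a ↾≥ M) ≡ 2
    rL+t≡2 = trans (sym (size-split a M)) size≡2
    M≤n : M ≤ n
    M≤n = m≤n+o⇒m∸n≤o s (suc n) (begin
      s            ≡⟨ sum≡s ⟨
      elemSum a    ≤⟨ elemSum≤size*n a ⟩
      size a * n   ≡⟨ cong (_* n) size≡2 ⟩
      2 * n        ≤⟨ n≤1+n (2 * n) ⟩
      suc (2 * n)  ≡⟨ cong suc (solve (n ∷ [])) ⟩
      suc n + n    ∎)
      where open ≤-Reasoning
    no-low : ¬ (0 < size (a ↾< M))
    no-low pos = <-irrefl refl (begin-strict
      s                                             ≡⟨ sum≡s ⟨
      elemSum a                                     ≡⟨ weightedSum-split a M suc ⟩
      elemSum (a ↾< M) + elemSum (a ↾≥ M)           ≤⟨ +-mono-≤ (elemSum≤size* (a ↾< M) (↾<-supportedBelow a M))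
                                                                (elemSum≤size*n (a ↾≥ M)) ⟩
      size (a ↾< M) * M + size (a ↾≥ M) * n         ≤⟨ pair-arith rL+t≡2 pos M≤n ⟩
      M + n                                         <⟨ +-monoʳ-< M (n<1+n n) ⟩
      M + suc n                                     ≡⟨ +-comm M (suc n) ⟩
      suc n + M                                     ≡⟨ threshold-split (0<threshold⇒n<s (↾<-nonempty⇒0<M a M pos)) ⟩
      s                                             ∎)
      where open ≤-Reasoning
    rL≡0 : size (a ↾< M) ≡ 0
    rL≡0 = n≤0⇒n≡0 (≮⇒≥ no-low)

  pair-above-half : ∀ {m} → size a ≡ 2 → elemSum a ≡ 2 * m → 0 < size (a ↾≥ m)
  pair-above-half {m} size≡2 sum≡2m = n≢0⇒n>0 λ t≡0 →
    let 2S+r²≤r[2m+1] = proj₂ (top-bound a m a≤1 (↾≥-empty a m t≡0))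
    in <-irrefl refl (begin-strict
      4 * m + 2                             <⟨ +-monoʳ-< (4 * m) (s≤s (s≤s (s≤s z≤n))) ⟩
      4 * m + 4                             ≡⟨ solve (m ∷ []) ⟩
      2 * (2 * m) + 2 * 2                   ≡⟨ cong₂ (λ S r → 2 * S + r * r) sum≡2m size≡2 ⟨
      2 * elemSum a + size a * size a       ≤⟨ 2S+r²≤r[2m+1] ⟩
      size a * (2 * m + 1)                  ≡⟨ cong (_* (2 * m + 1)) size≡2 ⟩
      2 * (2 * m + 1)                       ≡⟨ solve (m ∷ []) ⟩
      4 * m + 2                             ∎)
    where open ≤-Reasoning

  -- The conclusion says s ≤ m + Σ_{i=c-p′}^{c-1} i: at most one element lies in C and it is
  -- at most m, the others are distinct and below c.
  p-block-bound : ∀ {s m p′} → size a ≡ suc p′ → 0 < p′ → elemSum a ≡ s → s ∸ suc n ≤ m →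
    size (a ↾≥ m) ≡ 0 → size (a ↾≥ (s ∸ suc n)) ≤ 1 →
    n < s × 2 * s + p′ * p′ ≤ p′ * (2 * (s ∸ suc n) + 1) + 2 * m
  p-block-bound {s} {m} {p′} size≡ p′>0 sum≡s M≤m b≡0 t≤1 = n<s , (begin
    2 * s + p′ * p′
      ≡⟨ cong (λ S → 2 * S + p′ * p′) (trans (sym sum≡s) (weightedSum-split a M suc)) ⟩
    2 * (elemSum (a ↾< M) + elemSum (a ↾≥ M)) + p′ * p′
      ≤⟨ p-block-arith {SL = elemSum (a ↾< M)} t+rL≡ t≤1 (proj₂ top) SH≤ M≤m ⟩
    p′ * (2 * M + 1) + 2 * m ∎)
    where
    open ≤-Reasoning
    M = s ∸ suc n
    t+rL≡ : size (a ↾≥ M) + size (a ↾< M) ≡ suc p′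
    t+rL≡ = trans (+-comm (size (a ↾≥ M)) _) (trans (sym (size-split a M)) size≡)
    top = top-bound (a ↾< M) M (↾<-zeroOne a M a≤1) (↾<-supportedBelow a M)
    SH≤ : elemSum (a ↾≥ M) ≤ size (a ↾≥ M) * m
    SH≤ = elemSum≤size* (a ↾≥ M) (λ j m≤j → cong (_* atLeast M (toℕ j)) (↾≥-empty a m b≡0 j m≤j))
    p′≤rL : p′ ≤ size (a ↾< M)
    p′≤rL = ≤-pred (subst (_≤ suc (size (a ↾< M))) t+rL≡ (+-monoˡ-≤ (size (a ↾< M)) t≤1))
    n<s : n < s
    n<s = 0<threshold⇒n<s (↾<-nonempty⇒0<M a M (<-≤-trans p′>0 p′≤rL))

  p-block : ∀ {s m p′} → size a ≡ suc p′ → 0 < p′ → elemSum a ≡ s → s ∸ suc n ≤ m →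
    (n < s → 2 * m + p′ * (2 * (s ∸ suc n) + 1) < 2 * s + p′ * p′) →
    0 < size (a ↾≥ m) ⊎ 2 ≤ size (a ↾≥ (s ∸ suc n))
  p-block {s} {m} {p′} size≡ p′>0 sum≡s M≤m H1
    with size (a ↾≥ m) ≟ 0 | 2 ≤? size (a ↾≥ (s ∸ suc n))
  ... | no  b≢0 | _       = inj₁ (n≢0⇒n>0 b≢0)
  ... | yes _   | yes t≥2 = inj₂ t≥2
  ... | yes b≡0 | no  t≱2 =
    let n<s , bound = p-block-bound size≡ p′>0 sum≡s M≤m b≡0 (≤-pred (≰⇒> t≱2))
    in contradiction (subst (_< 2 * s + p′ * p′) (+-comm (2 * m) _) (H1 n<s)) (≤⇒≯ bound)

  small-block-meets-C : ∀ {s q} → elemSum a ≡ s → 0 < size a → size a ≤ q → q * q + q ≤ 2 * s →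
    (n < s → q * (2 * (s ∸ suc n) + 1) < 2 * s + q * q) → 0 < size (a ↾≥ (s ∸ suc n))
  small-block-meets-C {s} {q} sum≡s pos r≤q bottom H2 = n≢0⇒n>0 λ t≡0 →
    let r≤M , top = top-bound a (s ∸ suc n) a≤1 (↾≥-empty a (s ∸ suc n) t≡0)
    in small-block-arith {s = s} r≤q r≤M
         (subst (λ S → 2 * S + size a * size a ≤ size a * (2 * (s ∸ suc n) + 1)) sum≡s top) bottom
         (H2 (0<threshold⇒n<s (<-≤-trans pos r≤M)))

sumFrom : ℤ → ℕ → ℤ
sumFrom a L = foldr ℤ._+_ (+ 0) (map (λ j → a ℤ.+ + j) (upTo L))

sumFrom-suc : ∀ a L → sumFrom a (suc L) ≡ a ℤ.+ + 0 ℤ.+ sumFrom (a ℤ.+ + 1) L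
sumFrom-suc a L = cong (λ xs → a ℤ.+ + 0 ℤ.+ foldr ℤ._+_ (+ 0) xs) (begin
  map (λ j → a ℤ.+ + j) (applyUpTo suc L)        ≡⟨ map-applyUpTo suc (λ j → a ℤ.+ + j) L ⟩
  applyUpTo (λ j → a ℤ.+ + suc j) L              ≡⟨ map-upTo (λ j → a ℤ.+ + suc j) L ⟨
  map (λ j → a ℤ.+ (+ 1 ℤ.+ + j)) (upTo L)       ≡⟨ map-cong (λ j → ℤ.+-assoc a (+ 1) (+ j)) (upTo L) ⟨
  map (λ j → a ℤ.+ + 1 ℤ.+ + j) (upTo L)         ∎)
  where open ≡-Reasoning

sumFrom-closed : ∀ a L → + 2 ℤ.* sumFrom a L ≡ + L ℤ.* (+ 2 ℤ.* a ℤ.+ + L ℤ.- + 1)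
sumFrom-closed a zero    = refl
sumFrom-closed a (suc L) = begin
  + 2 ℤ.* sumFrom a (suc L)
    ≡⟨ cong (ℤ._*_ (+ 2)) (sumFrom-suc a L) ⟩
  + 2 ℤ.* (a ℤ.+ + 0 ℤ.+ sumFrom (a ℤ.+ + 1) L)
    ≡⟨ ℤ.*-distribˡ-+ (+ 2) (a ℤ.+ + 0) _ ⟩
  + 2 ℤ.* (a ℤ.+ + 0) ℤ.+ + 2 ℤ.* sumFrom (a ℤ.+ + 1) L
    ≡⟨ cong (ℤ._+_ (+ 2 ℤ.* (a ℤ.+ + 0))) (sumFrom-closed (a ℤ.+ + 1) L) ⟩
  + 2 ℤ.* (a ℤ.+ + 0) ℤ.+ + L ℤ.* (+ 2 ℤ.* (a ℤ.+ + 1) ℤ.+ + L ℤ.- + 1)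
    ≡⟨ step a (+ L) ⟩
  (+ 1 ℤ.+ + L) ℤ.* (+ 2 ℤ.* a ℤ.+ (+ 1 ℤ.+ + L) ℤ.- + 1) ∎
  where
  open ≡-Reasoning
  step : ∀ a L → + 2 ℤ.* (a ℤ.+ + 0) ℤ.+ L ℤ.* (+ 2 ℤ.* (a ℤ.+ + 1) ℤ.+ L ℤ.- + 1)
               ≡ (+ 1 ℤ.+ L) ℤ.* (+ 2 ℤ.* a ℤ.+ (+ 1 ℤ.+ L) ℤ.- + 1)
  step = ℤ-Solver.solve-∀

rangeLength-≡ : ∀ a b L → b ℤ.- a ℤ.+ + 1 ≡ + L → rangeLength a b ≡ L
rangeLength-≡ a b L eq with b ℤ.- a ℤ.+ + 1
rangeLength-≡ a b L refl | .(+ L) = refl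

rangeSum-closed : ∀ a b L → b ℤ.- a ℤ.+ + 1 ≡ + L → + 2 ℤ.* rangeSum a b ≡ + L ℤ.* (a ℤ.+ b)
rangeSum-closed a b L eq = begin
  + 2 ℤ.* sumFrom a (rangeLength a b)
    ≡⟨ cong (λ l → + 2 ℤ.* sumFrom a l) (rangeLength-≡ a b L eq) ⟩
  + 2 ℤ.* sumFrom a L
    ≡⟨ sumFrom-closed a L ⟩
  + L ℤ.* (+ 2 ℤ.* a ℤ.+ + L ℤ.- + 1)
    ≡⟨ cong (λ l → + L ℤ.* (+ 2 ℤ.* a ℤ.+ l ℤ.- + 1)) eq ⟨
  + L ℤ.* (+ 2 ℤ.* a ℤ.+ (b ℤ.- a ℤ.+ + 1) ℤ.- + 1)
    ≡⟨ cong (ℤ._*_ (+ L)) (ends a b) ⟩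
  + L ℤ.* (a ℤ.+ b) ∎
  where
  open ≡-Reasoning
  ends : ∀ a b → + 2 ℤ.* a ℤ.+ (b ℤ.- a ℤ.+ + 1) ℤ.- + 1 ≡ a ℤ.+ b
  ends = ℤ-Solver.solve-∀

rangeSum-below : ∀ c r a → a ≡ c ℤ.- + r →
  + 2 ℤ.* rangeSum a (c ℤ.- + 1) ≡ + r ℤ.* (+ 2 ℤ.* c ℤ.- + r ℤ.- + 1)
rangeSum-below c r a refl =
  trans (rangeSum-closed (c ℤ.- + r) (c ℤ.- + 1) r (length c (+ r))) (cong (ℤ._*_ (+ r)) (ends c (+ r)))
  where
  length : ∀ c r → c ℤ.- + 1 ℤ.- (c ℤ.- r) ℤ.+ + 1 ≡ r
  length = ℤ-Solver.solve-∀
  ends : ∀ c r → c ℤ.- r ℤ.+ (c ℤ.- + 1) ≡ + 2 ℤ.* c ℤ.- r ℤ.- + 1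
  ends = ℤ-Solver.solve-∀

+[m+n]-m≡+n : ∀ m n → + (m + n) ℤ.- + m ≡ + n
+[m+n]-m≡+n m n = trans (cong (ℤ._- + m) (ℤ.pos-+ m n)) (cancel (+ m) (+ n))
  where
  cancel : ∀ m n → m ℤ.+ n ℤ.- m ≡ n
  cancel = ℤ-Solver.solve-∀

-- With c = s - n = M + 1, twice Σ_{i=c-r}^{c-1} i equals r(2M + 1) - r².
rangeSum-below-c : ∀ {n s} r a → n < s → a ≡ (+ s ℤ.- + n) ℤ.- + r →
  + 2 ℤ.* rangeSum a ((+ s ℤ.- + n) ℤ.- + 1) ℤ.+ + (r * r) ≡ + (r * (2 * (s ∸ suc n) + 1))
rangeSum-below-c {n} {s} r a n<s a≡ = begin
  + 2 ℤ.* rangeSum a (c ℤ.- + 1) ℤ.+ + (r * r)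
    ≡⟨ cong₂ ℤ._+_ (rangeSum-below c r a a≡) (ℤ.pos-* r r) ⟩
  + r ℤ.* (+ 2 ℤ.* c ℤ.- + r ℤ.- + 1) ℤ.+ + r ℤ.* + r
    ≡⟨ cong (λ x → + r ℤ.* (+ 2 ℤ.* x ℤ.- + r ℤ.- + 1) ℤ.+ + r ℤ.* + r) c≡1+M ⟩
  + r ℤ.* (+ 2 ℤ.* (+ 1 ℤ.+ + M) ℤ.- + r ℤ.- + 1) ℤ.+ + r ℤ.* + r
    ≡⟨ simplify (+ r) (+ M) ⟩
  + r ℤ.* (+ 2 ℤ.* + M ℤ.+ + 1)
    ≡⟨ cong (λ x → + r ℤ.* (x ℤ.+ + 1)) (ℤ.pos-* 2 M) ⟨
  + r ℤ.* + (2 * M + 1)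
    ≡⟨ ℤ.pos-* r (2 * M + 1) ⟨
  + (r * (2 * M + 1)) ∎
  where
  open ≡-Reasoning
  c = + s ℤ.- + n
  M = s ∸ suc n
  c≡1+M : c ≡ + 1 ℤ.+ + M
  c≡1+M = begin
    + s ℤ.- + n         ≡⟨ cong (λ x → + x ℤ.- + n) (threshold-split n<s) ⟨
    + (suc n + M) ℤ.- + n ≡⟨ cong (λ x → + x ℤ.- + n) (sym (+-suc n M)) ⟩
    + (n + suc M) ℤ.- + n ≡⟨ +[m+n]-m≡+n n (suc M) ⟩
    + suc M             ∎
  simplify : ∀ r M →
    r ℤ.* (+ 2 ℤ.* (+ 1 ℤ.+ M) ℤ.- r ℤ.- + 1) ℤ.+ r ℤ.* r ≡ r ℤ.* (+ 2 ℤ.* M ℤ.+ + 1)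
  simplify = ℤ-Solver.solve-∀

double-<-shift : ∀ {x A B C} → + 2 ℤ.* x ℤ.+ + B ≡ + A → x ℤ.< + C → A < 2 * C + B
double-<-shift {x} {A} {B} {C} eq x<C =
  ℤ.drop‿+<+ (subst₂ ℤ._<_ eq (cong (ℤ._+ + B) (sym (ℤ.pos-* 2 C)))
                            (ℤ.+-monoˡ-< (+ B) (ℤ.*-monoˡ-<-pos (+ 2) x<C)))

m+rangeSum<s⇒ℕ : ∀ {n s m p′} →
  + m ℤ.+ rangeSum ((+ s ℤ.- + n) ℤ.- + suc p′ ℤ.+ + 1) ((+ s ℤ.- + n) ℤ.- + 1) ℤ.< + s →
  n < s → 2 * m + p′ * (2 * (s ∸ suc n) + 1) < 2 * s + p′ * p′
m+rangeSum<s⇒ℕ {n} {s} {m} {p′} H n<s = double-<-shift eq H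
  where
  open ≡-Reasoning
  c = + s ℤ.- + n
  R = rangeSum (c ℤ.- + suc p′ ℤ.+ + 1) (c ℤ.- + 1)
  regroup : ∀ m R q → + 2 ℤ.* (m ℤ.+ R) ℤ.+ q ≡ + 2 ℤ.* m ℤ.+ (+ 2 ℤ.* R ℤ.+ q)
  regroup = ℤ-Solver.solve-∀
  shift : ∀ c p → c ℤ.- (+ 1 ℤ.+ p) ℤ.+ + 1 ≡ c ℤ.- p
  shift = ℤ-Solver.solve-∀
  eq : + 2 ℤ.* (+ m ℤ.+ R) ℤ.+ + (p′ * p′) ≡ + (2 * m + p′ * (2 * (s ∸ suc n) + 1))
  eq = begin
    + 2 ℤ.* (+ m ℤ.+ R) ℤ.+ + (p′ * p′)
      ≡⟨ regroup (+ m) R (+ (p′ * p′)) ⟩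
    + 2 ℤ.* + m ℤ.+ (+ 2 ℤ.* R ℤ.+ + (p′ * p′))
      ≡⟨ cong₂ ℤ._+_ (sym (ℤ.pos-* 2 m)) (rangeSum-below-c {n} {s} p′ _ n<s (shift c (+ p′))) ⟩
    + (2 * m) ℤ.+ + (p′ * (2 * (s ∸ suc n) + 1)) ∎

rangeSum<s⇒ℕ : ∀ {n s q} → rangeSum ((+ s ℤ.- + n) ℤ.- + q) ((+ s ℤ.- + n) ℤ.- + 1) ℤ.< + s →
  n < s → q * (2 * (s ∸ suc n) + 1) < 2 * s + q * q
rangeSum<s⇒ℕ {n} {s} {q} H n<s = double-<-shift (rangeSum-below-c {n} {s} q _ n<s refl) H

half-odd : ∀ X → suc (2 * X) / 2 ≡ X
half-odd X = begin
  suc (2 * X) / 2     ≡⟨ cong (λ y → suc y / 2) (*-comm 2 X) ⟩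
  (1 + X * 2) / 2     ≡⟨ +-distrib-/-∣ʳ 1 {X * 2} {2} (divides-refl X) ⟩
  1 / 2 + X * 2 / 2   ≡⟨ m*n/n≡m X 2 ⟩
  X                   ∎
  where open ≡-Reasoning

floorHalf-odd : ∀ X → floorHalf (+ suc (2 * X)) ≡ + X
floorHalf-odd X = trans (ℤ.*-identityˡ _) (cong +_ (half-odd X))

gValue-odd-≤ : ∀ {X f} → f ≤ X → gValue (+ suc (2 * X)) f ≡ + suc (2 * X) ℤ.- + f
gValue-odd-≤ {X} {f} f≤X with + f ℤ.≤? floorHalf (+ suc (2 * X))
... | yes _   = refl
... | no  f≰h = contradiction (subst (+ f ℤ.≤_) (sym (floorHalf-odd X)) (ℤ.+≤+ f≤X)) f≰h

gValue-odd-> : ∀ {X f} → X < f → gValue (+ suc (2 * X)) f ≡ + (3 * X + 1) ℤ.- + (2 * f)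
gValue-odd-> {X} {f} X<f with + f ℤ.≤? floorHalf (+ suc (2 * X))
... | yes f≤h = contradiction (ℤ.drop‿+≤+ (subst (+ f ℤ.≤_) (floorHalf-odd X) f≤h)) (<⇒≱ X<f)
... | no  _   = begin
  + suc (2 * X) ℤ.- h/2 ℤ.- + 2 ℤ.* (+ f ℤ.- h/2)
    ≡⟨ cong (λ y → + suc (2 * X) ℤ.- y ℤ.- + 2 ℤ.* (+ f ℤ.- y)) (floorHalf-odd X) ⟩
  + 1 ℤ.+ + (2 * X) ℤ.- + X ℤ.- + 2 ℤ.* (+ f ℤ.- + X)
    ≡⟨ cong (λ y → + 1 ℤ.+ y ℤ.- + X ℤ.- + 2 ℤ.* (+ f ℤ.- + X)) (ℤ.pos-* 2 X) ⟩
  + 1 ℤ.+ + 2 ℤ.* + X ℤ.- + X ℤ.- + 2 ℤ.* (+ f ℤ.- + X)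
    ≡⟨ simplify (+ X) (+ f) ⟩
  + 3 ℤ.* + X ℤ.+ + 1 ℤ.- + 2 ℤ.* + f
    ≡⟨ cong₂ (λ y z → y ℤ.+ + 1 ℤ.- z) (ℤ.pos-* 3 X) (ℤ.pos-* 2 f) ⟨
  + (3 * X + 1) ℤ.- + (2 * f) ∎
  where
  open ≡-Reasoning
  h/2 = floorHalf (+ suc (2 * X))
  simplify : ∀ X f →
    + 1 ℤ.+ + 2 ℤ.* X ℤ.- X ℤ.- + 2 ℤ.* (f ℤ.- X) ≡ + 3 ℤ.* X ℤ.+ + 1 ℤ.- + 2 ℤ.* f
  simplify = ℤ-Solver.solve-∀

h-odd : ∀ X e → + (2 * (X + e) + 1) ℤ.- + (2 * e) ≡ + suc (2 * X)
h-odd X e = trans (cong (λ y → + y ℤ.- + (2 * e)) (regroup X e)) (+[m+n]-m≡+n (2 * e) (suc (2 * X)))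
  where
  regroup : ∀ X e → 2 * (X + e) + 1 ≡ 2 * e + suc (2 * X)
  regroup = solve-∀

+-+cancel : ∀ A B → + A ℤ.- + B ℤ.+ + B ≡ + A
+-+cancel A B = cancel (+ A) (+ B)
  where
  cancel : ∀ a b → a ℤ.- b ℤ.+ b ≡ a
  cancel = ℤ-Solver.solve-∀

-<0⇒< : ∀ {A B} → + A ℤ.- + B ℤ.< + 0 → A < B
-<0⇒< {A} {B} lt =
  ℤ.drop‿+<+ (subst₂ ℤ._<_ (+-+cancel A B) (ℤ.+-identityˡ (+ B)) (ℤ.+-monoˡ-< (+ B) lt))

-≡+⇒+≡ : ∀ {A B C} → + A ℤ.- + B ≡ + C → C + B ≡ A
-≡+⇒+≡ {A} {B} eq = ℤ.+-injective (trans (cong (ℤ._+ + B) (sym eq)) (+-+cancel A B))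

block : ∀ {n k} → (Fin n → Fin k) → Fin k → Fin n → ℕ
block σ i j = ifEq (σ j) i 1 0

module _ {n k} (σ : Fin n → Fin k) where

  block-zeroOne : ∀ i → ZeroOne (block σ i)
  block-zeroOne i j = ifEq-≤1 (σ j) i

  blockSum≡elemSum : ∀ i → blockSum σ i ≡ elemSum (block σ i)
  blockSum≡elemSum i = sumFin-cong n (λ j → ifEq-* (σ j) i (suc (toℕ j)))

  sumFin-blocks : ∀ w → sumFin k (λ i → weightedSum (block σ i) w) ≡ sumFin n (λ j → w (toℕ j))
  sumFin-blocks w = trans (sumFin-comm k n (λ i j → block σ i j * w (toℕ j))) (sumFin-cong n λ j → begin
    sumFin k (λ i → block σ i j * w (toℕ j))   ≡⟨ sumFin-*ʳ k (λ i → block σ i j) (w (toℕ j)) ⟩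
    sumFin k (λ i → block σ i j) * w (toℕ j)   ≡⟨ cong (_* w (toℕ j)) (sumFin-ifEq k (σ j)) ⟩
    1 * w (toℕ j)                              ≡⟨ *-identityˡ (w (toℕ j)) ⟩
    w (toℕ j)                                  ∎)
    where open ≡-Reasoning

gauss : ∀ n → 2 * sumFin n (λ j → suc (toℕ j)) ≡ n * suc n
gauss zero    = refl
gauss (suc n) = begin
  2 * (1 + sumFin n (λ j → 1 + suc (toℕ j)))   ≡⟨ cong (λ x → 2 * (1 + x)) (sumFin-+ n (λ _ → 1) _) ⟩
  2 * (1 + (sumFin n (λ _ → 1) + S))           ≡⟨ cong (λ x → 2 * (1 + (x + S))) (sumFin-const n 1) ⟩
  2 * (1 + (n * 1 + S))                        ≡⟨ cong (λ x → 2 * (1 + (x + S))) (*-identityʳ n) ⟩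
  2 * (1 + (n + S))                            ≡⟨ regroup n S ⟩
  2 + 2 * n + 2 * S                            ≡⟨ cong (_+_ (2 + 2 * n)) (gauss n) ⟩
  2 + 2 * n + n * suc n                        ≡⟨ solve (n ∷ []) ⟩
  suc n * suc (suc n)                          ∎
  where
  open ≡-Reasoning
  S = sumFin n (λ j → suc (toℕ j))
  regroup : ∀ n S → 2 * (1 + (n + S)) ≡ 2 + 2 * n + 2 * S
  regroup = solve-∀

elemSum-block≡s : ∀ {n k s} (σ : Fin n → Fin k) → (∀ i i′ → blockSum σ i ≡ blockSum σ i′) →
  (2 * k) * s ≡ n * suc n → ∀ i → elemSum (block σ i) ≡ s
elemSum-block≡s {n} {suc k} {s} σ sums≡ 2ks≡ i = *-cancelˡ-≡ B s (2 * suc k) (begin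
  2 * suc k * B                                ≡⟨ *-assoc 2 (suc k) B ⟩
  2 * (suc k * B)                              ≡⟨ cong (2 *_) (sumFin-const (suc k) B) ⟨
  2 * sumFin (suc k) (λ _ → B)                 ≡⟨ cong (2 *_) (sumFin-cong (suc k) B≡) ⟨
  2 * sumFin (suc k) (λ i′ → elemSum (block σ i′)) ≡⟨ cong (2 *_) (sumFin-blocks σ suc) ⟩
  2 * sumFin n (λ j → suc (toℕ j))             ≡⟨ gauss n ⟩
  n * suc n                                    ≡⟨ 2ks≡ ⟨
  2 * suc k * s                                ∎)
  where
  open ≡-Reasoning
  B = elemSum (block σ i)
  B≡ : ∀ i′ → elemSum (block σ i′) ≡ B
  B≡ i′ = trans (sym (blockSum≡elemSum σ i′)) (trans (sums≡ i′ i) (blockSum≡elemSum σ i))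

-- Counting elements of C

Covered : ∀ {k} → (Fin k → ℕ) → Fin k → Set
Covered t j = ∀ i → toℕ i ≤ toℕ j → 1 ≤ t i

-- Alternatives (i) and (ii) of the theorem, with Σ_{i=c-q}^{c-1} i < s replaced by its
-- consequence that the blocks up to j all meet C.
g-condition : ∀ {k} → (Fin k → ℕ) → ℕ → ℕ → ℤ → Set
g-condition {k} t e f g =
  g ℤ.< + 0 ⊎ Σ[ g′ ∈ ℕ ] (g ≡ + g′ × Σ[ j ∈ Fin k ] (toℕ j ≡ e + f + g′ × Covered t j))

module _ {k} (t b : Fin k → ℕ) {e f : ℕ}
  (pair : ∀ i → toℕ i < e → t i ≡ 2 × 1 ≤ b i)
  (p-blk : ∀ i → e ≤ toℕ i → toℕ i < e + f → 2 ≤ t i + b i) where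

  staircase₂ : ∀ A → e ≤ k → A ≤ k → (∀ i → e ≤ toℕ i → toℕ i < A → 1 ≤ t i) → e + A ≤ sumFin k t
  staircase₂ A e≤k A≤k covered = begin
    e + A                                              ≡⟨ cong₂ _+_ (sumFin-below k e e≤k) (sumFin-below k A A≤k) ⟨
    sumFin k (λ i → below e (toℕ i)) + sumFin k (λ i → below A (toℕ i)) ≡⟨ sumFin-+ k _ _ ⟨
    sumFin k (λ i → below e (toℕ i) + below A (toℕ i)) ≤⟨ sumFin-mono k step ⟩
    sumFin k t                                         ∎
    where
    open ≤-Reasoning
    step : ∀ i → below e (toℕ i) + below A (toℕ i) ≤ t i
    step i = below-+-≤ e (toℕ i)
      (λ i<e → subst (suc (below A (toℕ i)) ≤_) (sym (proj₁ (pair i i<e)))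
                     (s≤s (below≤1 A (toℕ i))))
      (λ e≤i → below-≤ A (toℕ i) (covered i e≤i))

  staircase₃ : ∀ A → e + f ≤ k → A ≤ k → (∀ i → e + f ≤ toℕ i → toℕ i < A → 1 ≤ t i) →
    e + (e + f + A) ≤ sumFin k t + sumFin k b
  staircase₃ A E≤k A≤k covered = begin
    e + (E + A)
      ≡⟨ cong₂ _+_ (sumFin-below k e e≤k) (cong₂ _+_ (sumFin-below k E E≤k) (sumFin-below k A A≤k)) ⟨
    sumFin k (below e ∘ toℕ) + (sumFin k (below E ∘ toℕ) + sumFin k (below A ∘ toℕ))
      ≡⟨ trans (sumFin-+ k _ _) (cong (_+_ _) (sumFin-+ k _ _)) ⟨
    sumFin k (λ i → below e (toℕ i) + (below E (toℕ i) + below A (toℕ i)))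
      ≤⟨ sumFin-mono k step ⟩
    sumFin k (λ i → t i + b i)
      ≡⟨ sumFin-+ k t b ⟩
    sumFin k t + sumFin k b ∎
    where
    open ≤-Reasoning
    E = e + f
    e≤k = ≤-trans (m≤m+n e f) E≤k
    step : ∀ i → below e (toℕ i) + (below E (toℕ i) + below A (toℕ i)) ≤ t i + b i
    step i = below-+-≤ e (toℕ i)
      (λ i<e → let t≡2 , 1≤b = pair i i<e in begin
         suc (below E (toℕ i) + below A (toℕ i))
           ≤⟨ s≤s (+-mono-≤ (below≤1 E (toℕ i)) (below≤1 A (toℕ i))) ⟩
         3
           ≤⟨ +-mono-≤ (≤-reflexive (sym t≡2)) 1≤b ⟩
         t i + b i ∎)
      (λ e≤i → below-+-≤ E (toℕ i)
         (λ i<E → ≤-trans (s≤s (below≤1 A (toℕ i))) (p-blk i e≤i i<E))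
         (λ E≤i → below-≤ A (toℕ i) (λ i<A → ≤-trans (covered i E≤i i<A) (m≤m+n (t i) (b i)))))

  few-p-blocks : ∀ {X} → f ≤ X → e + f ≤ k → sumFin k t ≤ 2 * (X + e) + 1 →
    ¬ g-condition t e f (gValue (+ suc (2 * X)) f)
  few-p-blocks {X} f≤X E≤k Σt≤ (inj₁ g<0) =
    <⇒≱ (-<0⇒< (subst (ℤ._< + 0) (gValue-odd-≤ f≤X) g<0))
        (≤-trans f≤X (≤-trans (m≤n*m X 2) (n≤1+n _)))
  few-p-blocks {X} f≤X E≤k Σt≤ (inj₂ (g′ , g≡ , j , j≡ , covered)) = <-irrefl refl (begin-strict
    2 * (X + e) + 1              <⟨ n<1+n _ ⟩
    suc (2 * (X + e) + 1)        ≡⟨ regroup X e ⟩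
    e + suc (e + suc (2 * X))    ≡⟨ cong (λ x → e + suc (e + x)) g′+f≡ ⟨
    e + suc (e + (g′ + f))       ≡⟨ cong (λ x → e + suc (e + x)) (+-comm g′ f) ⟩
    e + suc (e + (f + g′))       ≡⟨ cong (λ x → e + suc x) (+-assoc e f g′) ⟨
    e + suc (e + f + g′)         ≡⟨ cong (λ x → e + suc x) j≡ ⟨
    e + suc (toℕ j)              ≤⟨ staircase₂ (suc (toℕ j)) (≤-trans (m≤m+n e f) E≤k) (toℕ<n j)
                                      (λ i _ i<A → covered i (≤-pred i<A)) ⟩
    sumFin k t                   ≤⟨ Σt≤ ⟩
    2 * (X + e) + 1              ∎)
    where
    open ≤-Reasoning
    g′+f≡ : g′ + f ≡ suc (2 * X)
    g′+f≡ = -≡+⇒+≡ (trans (sym (gValue-odd-≤ f≤X)) g≡)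
    regroup : ∀ X e → suc (2 * (X + e) + 1) ≡ e + suc (e + suc (2 * X))
    regroup = solve-∀

  many-p-blocks : ∀ {X} → X < f → e + f ≤ k → sumFin k t ≤ 2 * (X + e) + 1 → sumFin k b ≤ X + e →
    ¬ g-condition t e f (gValue (+ suc (2 * X)) f)
  many-p-blocks {X} X<f E≤k Σt≤ Σb≤ (inj₁ g<0) = <⇒≱ 3X+1<2f (+-cancelˡ-≤ (3 * e) _ _ (begin
    3 * e + 2 * f                   ≡⟨ solve (e ∷ f ∷ []) ⟩
    e + (e + f + (e + f))           ≤⟨ staircase₃ (e + f) E≤k E≤k (λ _ E≤i i<E → contradiction E≤i (<⇒≱ i<E)) ⟩
    sumFin k t + sumFin k b         ≤⟨ +-mono-≤ Σt≤ Σb≤ ⟩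
    2 * (X + e) + 1 + (X + e)       ≡⟨ solve (X ∷ e ∷ []) ⟩
    3 * e + (3 * X + 1)             ∎))
    where
    open ≤-Reasoning
    3X+1<2f : 3 * X + 1 < 2 * f
    3X+1<2f = -<0⇒< (subst (ℤ._< + 0) (gValue-odd-> X<f) g<0)
  many-p-blocks {X} X<f E≤k Σt≤ Σb≤ (inj₂ (g′ , g≡ , j , j≡ , covered)) = <-irrefl refl (begin-strict
    2 * (X + e) + 1 + (X + e)         <⟨ n<1+n _ ⟩
    suc (2 * (X + e) + 1 + (X + e))   ≡⟨ regroup X e ⟩
    3 * e + (3 * X + 1) + 1           ≡⟨ cong (λ x → 3 * e + x + 1) g′+2f≡ ⟨
    3 * e + (g′ + 2 * f) + 1          ≡⟨ regroup′ e f g′ ⟩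
    e + (e + f + suc (e + f + g′))    ≡⟨ cong (λ x → e + (e + f + suc x)) j≡ ⟨
    e + (e + f + suc (toℕ j))         ≤⟨ staircase₃ (suc (toℕ j)) E≤k (toℕ<n j)
                                            (λ i _ i<A → covered i (≤-pred i<A)) ⟩
    sumFin k t + sumFin k b           ≤⟨ +-mono-≤ Σt≤ Σb≤ ⟩
    2 * (X + e) + 1 + (X + e)         ∎)
    where
    open ≤-Reasoning
    g′+2f≡ : g′ + 2 * f ≡ 3 * X + 1
    g′+2f≡ = -≡+⇒+≡ (trans (sym (gValue-odd-> X<f)) g≡)
    regroup : ∀ X e → suc (2 * (X + e) + 1 + (X + e)) ≡ 3 * e + (3 * X + 1) + 1
    regroup = solve-∀
    regroup′ : ∀ e f g′ → 3 * e + (g′ + 2 * f) + 1 ≡ e + (e + f + suc (e + f + g′))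
    regroup′ = solve-∀

  counting-contradiction : ∀ {Y} → e + f ≤ k → sumFin k t ≤ 2 * Y + 1 → sumFin k b ≤ Y →
    ¬ g-condition t e f (gValue (+ (2 * Y + 1) ℤ.- + (2 * e)) f)
  counting-contradiction {Y} E≤k Σt≤ Σb≤ cond
    with Y ∸ e
       | m∸n+n≡m {Y} {e} (≤-trans (prefix≤sumFin b (≤-trans (m≤m+n e f) E≤k) (λ i → proj₂ ∘ pair i)) Σb≤)
  ... | X | refl =
    [ (λ f≤X → few-p-blocks f≤X E≤k Σt≤) , (λ X<f → many-p-blocks X<f E≤k Σt≤ Σb≤) ]′ (≤-<-connex f X)
      (subst (λ h → g-condition t e f (gValue h f)) (h-odd X e) cond)

count-C-bound : ∀ {n m} → m ≤ n → n ∸ (2 * m ∸ suc n) ≤ 2 * (n ∸ m) + 1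
count-C-bound {n} {m} m≤n with m≤n⇒∃[o]m+o≡n m≤n
... | Y , refl = m≤n+o⇒m∸n≤o (m + Y) M (+-cancelˡ-≤ m _ _ (begin
  m + (m + Y)                   ≡⟨ solve (m ∷ Y ∷ []) ⟩
  2 * m + Y                     ≤⟨ +-monoˡ-≤ Y (m≤n+m∸n (2 * m) (suc (m + Y))) ⟩
  suc (m + Y) + M + Y           ≡⟨ regroup m Y M ⟩
  m + (M + (2 * Y + 1))         ≡⟨ cong (λ y → m + (M + (2 * y + 1))) (m+n∸m≡n m Y) ⟨
  m + (M + (2 * (m + Y ∸ m) + 1)) ∎))
  where
  open ≤-Reasoning
  M = 2 * m ∸ suc (m + Y)
  regroup : ∀ m Y M → suc (m + Y) + M + Y ≡ m + (M + (2 * Y + 1))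
  regroup = solve-∀

+[2n]-[2m]≡+2[n∸m] : ∀ {n m} → m ≤ n → + (2 * n) ℤ.- + (2 * m) ≡ + (2 * (n ∸ m))
+[2n]-[2m]≡+2[n∸m] {n} {m} m≤n = begin
  + (2 * n) ℤ.- + (2 * m)                   ≡⟨ cong (λ y → + (2 * y) ℤ.- + (2 * m)) (m+[n∸m]≡n m≤n) ⟨
  + (2 * (m + (n ∸ m))) ℤ.- + (2 * m)       ≡⟨ cong (λ y → + y ℤ.- + (2 * m)) (*-distribˡ-+ 2 m (n ∸ m)) ⟩
  + (2 * m + 2 * (n ∸ m)) ℤ.- + (2 * m)     ≡⟨ +[m+n]-m≡+n (2 * m) (2 * (n ∸ m)) ⟩
  + (2 * (n ∸ m))                           ∎
  where open ≡-Reasoning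

module BlockStatistics {n k} (σ : Fin n → Fin k) {s} (m : ℕ)
  (sum≡s : ∀ i → elemSum (block σ i) ≡ s) (s≡2m : s ≡ 2 * m) where

  -- t i = |A_i ∩ C| and b i = #{x ∈ A_i | x > m}.
  t : Fin k → ℕ
  t i = size (block σ i ↾≥ (s ∸ suc n))

  b : Fin k → ℕ
  b i = size (block σ i ↾≥ m)

  sumFin-b : sumFin k b ≡ n ∸ m
  sumFin-b = trans (sumFin-blocks σ (atLeast m)) (sumFin-atLeast n m)

  pair-stats : ∀ i → size (block σ i) ≡ 2 → t i ≡ 2 × 1 ≤ b i
  pair-stats i size≡2 =
    pair-⊆-C (block σ i) (block-zeroOne σ i) size≡2 (sum≡s i) ,
    pair-above-half (block σ i) (block-zeroOne σ i) {m} size≡2 (trans (sum≡s i) s≡2m)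

  pair⇒m≤n : ∀ i → size (block σ i) ≡ 2 → m ≤ n
  pair⇒m≤n i size≡2 = *-cancelˡ-≤ 2 (begin
    2 * m                    ≡⟨ trans (sym s≡2m) (sym (sum≡s i)) ⟩
    elemSum (block σ i)      ≤⟨ elemSum≤size*n (block σ i) ⟩
    size (block σ i) * n     ≡⟨ cong (_* n) size≡2 ⟩
    2 * n                    ∎)
    where open ≤-Reasoning

  meets-C : ∀ j → let q = size (block σ j) in (n < s → q * (2 * (s ∸ suc n) + 1) < 2 * s + q * q) →
    ∀ i → 0 < size (block σ i) → size (block σ i) ≤ q → 1 ≤ t i
  meets-C j H₂ i pos size≤ =
    small-block-meets-C (block σ i) (block-zeroOne σ i) (sum≡s i) pos size≤ bottom H₂
    where
    bottom = subst (λ S → size (block σ j) * size (block σ j) + size (block σ j) ≤ 2 * S) (sum≡s j)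
                   (bottom-bound (block σ j) (block-zeroOne σ j))

  module _ (m≤n : m ≤ n) where

    M≤m : s ∸ suc n ≤ m
    M≤m = m≤n+o⇒m∸n≤o s (suc n) (begin
      s            ≡⟨ s≡2m ⟩
      2 * m        ≡⟨ solve (m ∷ []) ⟩
      m + m        ≤⟨ +-monoˡ-≤ m (m≤n⇒m≤1+n m≤n) ⟩
      suc n + m    ∎)
      where open ≤-Reasoning

    p-stats : ∀ i {p′} → size (block σ i) ≡ suc p′ → 0 < p′ →
      (n < s → 2 * m + p′ * (2 * (s ∸ suc n) + 1) < 2 * s + p′ * p′) → 2 ≤ t i + b i
    p-stats i size≡ p′>0 H₁ with p-block (block σ i) (block-zeroOne σ i) size≡ p′>0 (sum≡s i) M≤m H₁
    ... | inj₁ 1≤b = +-mono-≤ (≤-trans 1≤b (size-↾≥-antitone (block σ i) M≤m)) 1≤b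
    ... | inj₂ 2≤t = ≤-trans 2≤t (m≤m+n (t i) (b i))

    sumFin-t≤ : sumFin k t ≤ 2 * (n ∸ m) + 1
    sumFin-t≤ = begin
      sumFin k t                   ≡⟨ sumFin-blocks σ (atLeast (s ∸ suc n)) ⟩
      sumFin n (λ j → atLeast (s ∸ suc n) (toℕ j)) ≡⟨ sumFin-atLeast n (s ∸ suc n) ⟩
      n ∸ (s ∸ suc n)              ≡⟨ cong (λ s → n ∸ (s ∸ suc n)) s≡2m ⟩
      n ∸ (2 * m ∸ suc n)          ≤⟨ count-C-bound m≤n ⟩
      2 * (n ∸ m) + 1              ∎
      where open ≤-Reasoning

theorem4p4 : (n k : ℕ) → 0 < k → k < n →
    (s m : ℕ) → (2 * k) * s ≡ n * suc n → s ≡ 2 * m →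
    (P : Fin k → ℕ) → IsAscendingPartition n k P →
    (e f p : ℕ) → 0 < e → 0 < f → 3 ≤ p → e + f ≤ k →
    (∀ i → toℕ i < e → P i ≡ 2) →
    (∀ i → e ≤ toℕ i → toℕ i < e + f → P i ≡ p) →
    (∀ i → e + f ≤ toℕ i → p < P i) →
    let c : ℤ
        c = + s ℤ.- + n
        h : ℤ
        h = + (2 * n) ℤ.- + s ℤ.+ + 1 ℤ.- + (2 * e)
        g : ℤ
        g = gValue h f
    in
    + m ℤ.+ rangeSum (c ℤ.- + p ℤ.+ + 1) (c ℤ.- + 1) ℤ.< + s →
    (g ℤ.< + 0 ⊎
      (Σ[ g′ ∈ ℕ ] (g ≡ + g′ ×
        Σ[ j ∈ Fin k ] (toℕ j ≡ e + f + g′ ×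
          rangeSum (c ℤ.- + P j) (c ℤ.- + 1) ℤ.< + s)))) →
    ¬ Equitable n k P
theorem4p4 n k _ _ s m 2ks≡n[n+1] s≡2m P isP e f (suc p′) 0<e _ (s≤s 2≤p′) e+f≤k P≡2 P≡p _ H₁ H₂
           (σ , sizes , sums) =
  counting-contradiction t b pair p-blk e+f≤k (sumFin-t≤ m≤n) (≤-reflexive sumFin-b)
    (subst (λ h → g-condition t e f (gValue h f)) h≡ g-cond)
  where
  open IsAscendingPartition isP
  open BlockStatistics σ m (elemSum-block≡s σ sums 2ks≡n[n+1]) s≡2m
  pair : ∀ i → toℕ i < e → t i ≡ 2 × 1 ≤ b i
  pair i i<e = pair-stats i (trans (sizes i) (P≡2 i i<e))
  m≤n : m ≤ n
  m≤n = pair⇒m≤n i₀ (trans (sizes i₀) (P≡2 i₀ (subst (_< e) (sym (toℕ-fromℕ< _)) 0<e)))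
    where i₀ = Fin.fromℕ< (≤-trans 0<e (≤-trans (m≤m+n e f) e+f≤k))
  p-blk : ∀ i → e ≤ toℕ i → toℕ i < e + f → 2 ≤ t i + b i
  p-blk i e≤i i<e+f =
    p-stats m≤n i (trans (sizes i) (P≡p i e≤i i<e+f)) (≤-trans (s≤s z≤n) 2≤p′) (m+rangeSum<s⇒ℕ H₁)
  h≡ : + (2 * n) ℤ.- + s ℤ.+ + 1 ℤ.- + (2 * e) ≡ + (2 * (n ∸ m) + 1) ℤ.- + (2 * e)
  h≡ = cong (λ x → x ℤ.+ + 1 ℤ.- + (2 * e))
            (trans (cong (λ s → + (2 * n) ℤ.- + s) s≡2m) (+[2n]-[2m]≡+2[n∸m] m≤n))
  cover : ∀ {j} → rangeSum ((+ s ℤ.- + n) ℤ.- + P j) ((+ s ℤ.- + n) ℤ.- + 1) ℤ.< + s → Covered t j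
  cover {j} H i i≤j =
    meets-C j (subst (λ q → n < s → q * _ < 2 * s + q * q) (sym (sizes j)) (rangeSum<s⇒ℕ H)) i
      (subst (0 <_) (sym (sizes i)) (positive i))
      (subst₂ _≤_ (sym (sizes i)) (sym (sizes j)) (ascending i j i≤j))
  g-cond = Sum.map₂ (Product.map₂ (Product.map₂ (Product.map₂ (Product.map₂ cover)))) H₂
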